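{- Let $n\ge s\ge0$ be integers with $4n/11<s<3n/8$ and let $G\in\mathfrak{E}(n,s)$. Then fewer than $3s-n$ vertices $x\in V(G)$ satisfy $\deg_G(x)\le 4n-10s$; i.e., all but less than $3s-n$ vertices $x$ satisfy $\deg_G(x)>4n-10s$.
   Context: All graphs are finite and simple. For integers $n\ge s\ge 0$, $\mathrm{ex}(n,s)$ is the maximum number of edges in a triangle-free graph on $n$ vertices with independence number at most $s$, and $\mathfrak{E}(n,s)$ is the family of triangle-free graphs $G$ on $n$ vertices with $\alpha(G)\le s$ and exactly $\mathrm{ex}(n,s)$ edges. -}

module Defs where

open import Data.Nat using (ℕ; zero; suc; _+_; _≤_; _<_)
open import Data.Bool using (Bool; true; false; if_then_else_)
open import Data.Fin using (Fin; _<?_)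
open import Data.Fin.Subset using (Subset; _∈_; ∣_∣)
open import Data.List using (List; length; filter; allFin; map)
open import Data.Nat.ListAction using (sum)
open import Relation.Binary.PropositionalEquality using (_≡_)
open import Relation.Nullary using (¬_; does)

record Graph (n : ℕ) : Set where
  field
    adj   : Fin n → Fin n → Bool
    sym   : ∀ i j → adj i j ≡ adj j i
    irref : ∀ i → adj i i ≡ false
open Graph public

deg : ∀ {n} → Graph n → Fin n → ℕ
deg G x = length (filter (λ y → adj G x y ≡? true) (allFin _))
  where
  open import Data.Bool.Properties using () renaming (_≟_ to _≡?_)

edges : ∀ {n} → Graph n → ℕ
edges {n} G = sum (map (λ i → length (filter (λ j → does (i <? j) ∧' adj G i j ≡? true) (allFin n))) (allFin n))
  where
  open import Data.Bool using (_∧_)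
  open import Data.Bool.Properties using () renaming (_≟_ to _≡?_)
  _∧'_ : Bool → Bool → Bool
  a ∧' b = a ∧ b
  infixr 6 _∧'_

TriangleFree : ∀ {n} → Graph n → Set
TriangleFree G = ∀ x y z → adj G x y ≡ true → adj G y z ≡ true → adj G x z ≡ true → Data.Empty.⊥
  where import Data.Empty

Independent : ∀ {n} → Graph n → Subset n → Set
Independent G S = ∀ x y → x ∈ S → y ∈ S → adj G x y ≡ false

αAtMost : ∀ {n} → Graph n → ℕ → Set
αAtMost G s = ∀ S → Independent G S → ∣ S ∣ ≤ s

Admissible : ∀ {n} → ℕ → Graph n → Set
Admissible s G = TriangleFree G Data.Product.× αAtMost G s
  where import Data.Product

-- G ∈ 𝔈(n,s): admissible and edge-maximal among admissible graphs on n vertices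
-- (so edges G = ex(n,s)).
Extremal : (n s : ℕ) → Graph n → Set
Extremal n s G = Admissible s G Data.Product.× (∀ (H : Graph n) → Admissible s H → edges H ≤ edges G)
  where import Data.Product

-- number of vertices x with deg x + 10 s ≤ 4 n, i.e. deg x ≤ 4n - 10s (integers)
lowDegCount : ∀ {n} → Graph n → ℕ → ℕ
lowDegCount {n} G s = length (filter (λ x → (deg G x + 10 * s) ≤? (4 * n)) (allFin n))
  where open import Data.Nat using (_*_; _≤?_)

-- Let L be the number of low-degree vertices. Triangle-freeness makes every neighbourhood
-- independent, so every degree is at most s, while low vertices have degree at most 4n − 10s;
-- hence 2e(G) + L·(11s − 4n) ≤ sn. On the other side, the balanced blow-up H of the Andrásfai
-- graph And(4) on n vertices is triangle-free with independence number at most ⌊4n/11⌋ + 1 ≤ s,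
-- so maximality of G gives 2e(G) ≥ 2e(H) ≈ 4n²/11. Writing 11s = 4n + D, the two bounds give
-- 11·L·D ≤ 4n² + n·D − 11·2e(H), and an exact count of the edges of H, residue by residue of n
-- modulo 11, shows 4n² − 11·2e(H) < 3D². Hence 11L < n + 3D, which is L + n < 3s.
module Submission where

open import Defs hiding (sym)
open import Data.Nat using (ℕ; zero; suc; _+_; _*_; _∸_; _%_; _/_; _≡ᵇ_; _<ᵇ_; _≤_; _<_; _≤?_; z≤n; NonZero)
  renaming (_<?_ to _<ℕ?_)
open import Data.Nat.Properties
  using ( +-*-semiring; +-assoc; +-comm; +-suc; +-identityʳ; *-zeroʳ; *-identityʳ; *-comm; *-distribˡ-+; *-distribʳ-+
        ; ≤-refl; ≤-trans; <-≤-trans; m≤m+n; m≤n⇒∃[o]m+o≡n; m+[n∸m]≡n; [m+n]∸[m+o]≡n∸o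
        ; +-mono-≤; +-monoˡ-≤; +-monoʳ-≤; +-monoˡ-<; +-monoʳ-<; *-mono-≤; *-monoʳ-≤
        ; +-cancelˡ-≤; +-cancelʳ-≤; +-cancelˡ-<; *-cancelˡ-<; module ≤-Reasoning )
  renaming (_≟_ to _≟ℕ_)
open import Data.Nat.DivMod using (_divMod_; result; m≡m%n+[m/n]*n; m%n≤n; +-distrib-/-∣ˡ; m*n/n≡m; m<n*o⇒m/o<n)
open import Data.Nat.Divisibility using (n∣m*n)
open import Data.Nat.Tactic.RingSolver using (solve-∀)
open import Data.Bool using (Bool; true; false; _∧_)
open import Data.Bool.Properties using () renaming (_≟_ to _≟ᵇ_)
open import Data.Fin using (Fin; zero; suc; toℕ; #_; _↑ˡ_; _↑ʳ_; _<?_)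
open import Data.Fin.Properties using (_≟_; <-cmp; all?; any?)
open import Data.Fin.Subset using (Subset; _∈_; ∣_∣)
open import Data.Fin.Subset.Properties using (_∈?_; anySubset?)
open import Data.Vec using ([]; _∷_; lookup; tabulate)
open import Data.Vec.Properties using (lookup∘tabulate; []=⇒lookup; lookup⇒[]=)
open import Data.List using (length; filter; allFin; map)
import Data.List as List
import Data.Nat.ListAction as ListAction
open import Data.Product using (∃; _×_; _,_; proj₁; proj₂)
open import Data.Empty using (⊥-elim)
open import Function using (_∘_; id; flip)
open import Relation.Binary.Definitions using (tri<; tri≈; tri>)
open import Relation.Binary.PropositionalEquality
  using (_≡_; refl; sym; trans; cong; cong₂; subst; subst₂; module ≡-Reasoning)
open import Relation.Nullary using (Dec; does; yes; no)
open import Relation.Nullary.Decidable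
  using (toWitness; decidable-stable; map′; dec-true; dec-false; _×-dec_; _→-dec_; ¬?)
open import Relation.Unary using (Pred; Decidable)

open import Algebra.Properties.Semiring.Sum +-*-semiring

𝟙 : Bool → ℕ
𝟙 true = 1
𝟙 false = 0

𝟙-does-≟true : ∀ b → 𝟙 (does (b ≟ᵇ true)) ≡ 𝟙 b
𝟙-does-≟true true = refl
𝟙-does-≟true false = refl

∑-mono-≤ : ∀ {n} {f g : Fin n → ℕ} → (∀ i → f i ≤ g i) → ∑[ i < n ] f i ≤ ∑[ i < n ] g i
∑-mono-≤ {zero} f≤g = z≤n
∑-mono-≤ {suc n} f≤g = +-mono-≤ (f≤g zero) (∑-mono-≤ (f≤g ∘ suc))

∑-const : ∀ n c → ∑[ i < n ] c ≡ n * c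
∑-const zero c = refl
∑-const (suc n) c = cong (c +_) (∑-const n c)

∑-↑ : ∀ m {n} (f : Fin (m + n) → ℕ) → ∑[ i < m + n ] f i ≡ ∑[ i < m ] f (i ↑ˡ n) + ∑[ i < n ] f (m ↑ʳ i)
∑-↑ zero f = refl
∑-↑ (suc m) f = trans (cong (f zero +_) (∑-↑ m (f ∘ suc))) (sym (+-assoc (f zero) _ _))

∑-𝟙≟ : ∀ {k} (i : Fin k) (g : Fin k → ℕ) → ∑[ j < k ] (𝟙 (does (i ≟ j)) * g j) ≡ g i
∑-𝟙≟ {suc k} zero g = trans (cong (g zero + 0 +_) (sum-replicate-zero k)) (trans (+-identityʳ _) (+-identityʳ _))
∑-𝟙≟ {suc k} (suc i) g = ∑-𝟙≟ i (g ∘ suc)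

∑-shifted-weights : ∀ {k} q (c t : Fin k → ℕ) →
  ∑[ j < k ] ((q + c j) * t j) ≡ q * ∑[ j < k ] t j + ∑[ j < k ] (c j * t j)
∑-shifted-weights {k} q c t = begin
  ∑[ j < k ] ((q + c j) * t j)                   ≡⟨ sum-cong-≗ (λ j → *-distribʳ-+ (t j) q (c j)) ⟩
  ∑[ j < k ] (q * t j + c j * t j)               ≡⟨ ∑-distrib-+ (λ j → q * t j) (λ j → c j * t j) ⟩
  ∑[ j < k ] (q * t j) + ∑[ j < k ] (c j * t j)  ≡⟨ cong (_+ ∑[ j < k ] (c j * t j)) (*-distribˡ-sum q t) ⟨
  q * ∑[ j < k ] t j + ∑[ j < k ] (c j * t j)    ∎
  where open ≡-Reasoning

∑-shifted-quadraticForm : ∀ {k} q (c : Fin k → ℕ) (a : Fin k → Fin k → ℕ) →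
  ∑[ i < k ] ((q + c i) * ∑[ j < k ] ((q + c j) * a i j))
    ≡ q * q * ∑[ i < k ] ∑[ j < k ] a i j
      + q * ∑[ i < k ] (c i * ∑[ j < k ] a i j + ∑[ j < k ] (c j * a i j))
      + ∑[ i < k ] (c i * ∑[ j < k ] (c j * a i j))
∑-shifted-quadraticForm {k} q c a = begin
  ∑[ i < k ] ((q + c i) * ∑[ j < k ] ((q + c j) * a i j))
    ≡⟨ sum-cong-≗ (λ i → trans (cong ((q + c i) *_) (∑-shifted-weights q c (a i))) (expand q (c i) (d i) (N i))) ⟩
  ∑[ i < k ] (q * q * d i + q * (c i * d i + N i) + c i * N i)
    ≡⟨ ∑-distrib-+ (λ i → q * q * d i + q * (c i * d i + N i)) (λ i → c i * N i) ⟩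
  ∑[ i < k ] (q * q * d i + q * (c i * d i + N i)) + ∑[ i < k ] (c i * N i)
    ≡⟨ cong (_+ ∑[ i < k ] (c i * N i)) (∑-distrib-+ (λ i → q * q * d i) (λ i → q * (c i * d i + N i))) ⟩
  ∑[ i < k ] (q * q * d i) + ∑[ i < k ] (q * (c i * d i + N i)) + ∑[ i < k ] (c i * N i)
    ≡⟨ cong (_+ ∑[ i < k ] (c i * N i))
            (cong₂ _+_ (*-distribˡ-sum (q * q) d) (*-distribˡ-sum q (λ i → c i * d i + N i))) ⟨
  q * q * ∑[ i < k ] d i + q * ∑[ i < k ] (c i * d i + N i) + ∑[ i < k ] (c i * N i)
    ∎
  where
  open ≡-Reasoning
  d N : Fin k → ℕ
  d i = ∑[ j < k ] a i j
  N i = ∑[ j < k ] (c j * a i j)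
  expand : ∀ q ci di Ni → (q + ci) * (q * di + Ni) ≡ q * q * di + q * (ci * di + Ni) + ci * Ni
  expand = solve-∀

length-filter-tabulate : ∀ {a p} {A : Set a} {P : Pred A p} (P? : Decidable P) {n} (f : Fin n → A) →
  length (filter P? (List.tabulate f)) ≡ ∑[ i < n ] 𝟙 (does (P? (f i)))
length-filter-tabulate P? {zero} f = refl
length-filter-tabulate P? {suc n} f with does (P? (f zero))
... | true = cong suc (length-filter-tabulate P? (f ∘ suc))
... | false = length-filter-tabulate P? (f ∘ suc)

sum-map-tabulate : ∀ {a} {A : Set a} {n} (g : A → ℕ) (f : Fin n → A) →
  ListAction.sum (map g (List.tabulate f)) ≡ ∑[ i < n ] g (f i)
sum-map-tabulate {n = zero} g f = refl
sum-map-tabulate {n = suc n} g f = cong (g (f zero) +_) (sum-map-tabulate g (f ∘ suc))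

∣∣≡∑𝟙 : ∀ {n} (S : Subset n) → ∣ S ∣ ≡ ∑[ i < n ] 𝟙 (lookup S i)
∣∣≡∑𝟙 [] = refl
∣∣≡∑𝟙 (true ∷ S) = cong suc (∣∣≡∑𝟙 S)
∣∣≡∑𝟙 (false ∷ S) = ∣∣≡∑𝟙 S

∈-tabulate⁻ : ∀ {n} {f : Fin n → Bool} {j} → j ∈ tabulate f → f j ≡ true
∈-tabulate⁻ {f = f} {j} j∈ = trans (sym (lookup∘tabulate f j)) ([]=⇒lookup j∈)

∈-tabulate⁺ : ∀ {n} {f : Fin n → Bool} {j} → f j ≡ true → j ∈ tabulate f
∈-tabulate⁺ {f = f} {j} fj = lookup⇒[]= j (tabulate f) (trans (lookup∘tabulate f j) fj)

allSubsets? : ∀ {ℓ n} {Q : Pred (Subset n) ℓ} → Decidable Q → Dec (∀ T → Q T)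
allSubsets? Q? = map′ (λ ∄¬Q T → decidable-stable (Q? T) λ ¬QT → ∄¬Q (T , ¬QT))
                      (λ ∀Q (T , ¬QT) → ¬QT (∀Q T))
                      (¬? (anySubset? (¬? ∘ Q?)))

triangleFree? : ∀ {n} (G : Graph n) → Dec (TriangleFree G)
triangleFree? G = all? λ x → all? λ y → all? λ z →
  adj G x y ≟ᵇ true →-dec adj G y z ≟ᵇ true →-dec ¬? (adj G x z ≟ᵇ true)

independent? : ∀ {n} (G : Graph n) S → Dec (Independent G S)
independent? G S = all? λ x → all? λ y → x ∈? S →-dec y ∈? S →-dec adj G x y ≟ᵇ false

module _ {n : ℕ} (G : Graph n) where

  degreeSum : ℕ
  degreeSum = ∑[ x < n ] deg G x

  deg≡∑adj : ∀ x → deg G x ≡ ∑[ y < n ] 𝟙 (adj G x y)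
  deg≡∑adj x = trans (length-filter-tabulate (λ y → adj G x y ≟ᵇ true) id)
                     (sum-cong-≗ λ y → 𝟙-does-≟true (adj G x y))

  ascendingEdge : Fin n → Fin n → ℕ
  ascendingEdge i j = 𝟙 (does (i <? j) ∧ adj G i j)

  edges≡∑ascendingEdge : edges G ≡ ∑[ i < n ] ∑[ j < n ] ascendingEdge i j
  edges≡∑ascendingEdge = trans (sum-map-tabulate (λ i → length (filter (ascending? i) (allFin n))) id)
    (sum-cong-≗ λ i → trans (length-filter-tabulate (ascending? i) id)
                            (sum-cong-≗ λ j → 𝟙-does-≟true (does (i <? j) ∧ adj G i j)))
    where
    ascending? : ∀ i j → Dec (does (i <? j) ∧ adj G i j ≡ true)
    ascending? i j = does (i <? j) ∧ adj G i j ≟ᵇ true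

  𝟙adj-split : ∀ i j → 𝟙 (adj G i j) ≡ ascendingEdge i j + ascendingEdge j i
  𝟙adj-split i j with <-cmp i j
  ... | tri< i<j _ j≮i rewrite dec-true (i <? j) i<j | dec-false (j <? i) j≮i = sym (+-identityʳ _)
  ... | tri> i≮j _ j<i rewrite dec-false (i <? j) i≮j | dec-true (j <? i) j<i | Graph.sym G i j = refl
  ... | tri≈ i≮i refl _ rewrite dec-false (i <? i) i≮i | irref G i = refl

  handshake : degreeSum ≡ edges G + edges G
  handshake = begin
    ∑[ x < n ] deg G x
      ≡⟨ sum-cong-≗ deg≡∑adj ⟩
    ∑[ i < n ] ∑[ j < n ] 𝟙 (adj G i j)
      ≡⟨ sum-cong-≗ (λ i → trans (sum-cong-≗ (𝟙adj-split i))
                                 (∑-distrib-+ (ascendingEdge i) (flip ascendingEdge i))) ⟩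
    ∑[ i < n ] (∑[ j < n ] ascendingEdge i j + ∑[ j < n ] ascendingEdge j i)
      ≡⟨ ∑-distrib-+ (λ i → ∑[ j < n ] ascendingEdge i j) (λ i → ∑[ j < n ] ascendingEdge j i) ⟩
    ∑[ i < n ] ∑[ j < n ] ascendingEdge i j + ∑[ i < n ] ∑[ j < n ] ascendingEdge j i
      ≡⟨ cong₂ _+_ (sym edges≡∑ascendingEdge)
                   (trans (∑-comm (flip ascendingEdge)) (sym edges≡∑ascendingEdge)) ⟩
    edges G + edges G
      ∎
    where open ≡-Reasoning

  neighbourhood : Fin n → Subset n
  neighbourhood x = tabulate (adj G x)

  neighbourhood-independent : TriangleFree G → ∀ x → Independent G (neighbourhood x)
  neighbourhood-independent triangleFree x y z y∈ z∈ with adj G y z in yz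
  ... | false = refl
  ... | true = ⊥-elim (triangleFree x y z (∈-tabulate⁻ y∈) yz (∈-tabulate⁻ z∈))

  deg≤α : ∀ {s} → Admissible s G → ∀ x → deg G x ≤ s
  deg≤α (triangleFree , α≤s) x =
    subst (_≤ _) ∣neighbourhood∣≡deg (α≤s _ (neighbourhood-independent triangleFree x))
    where
    ∣neighbourhood∣≡deg : ∣ neighbourhood x ∣ ≡ deg G x
    ∣neighbourhood∣≡deg = trans (∣∣≡∑𝟙 (neighbourhood x))
      (trans (sum-cong-≗ λ y → cong 𝟙 (lookup∘tabulate (adj G x) y)) (sym (deg≡∑adj x)))

  lowDegCount≡∑ : ∀ s → lowDegCount G s ≡ ∑[ x < n ] 𝟙 (does (deg G x + 10 * s ≤? 4 * n))
  lowDegCount≡∑ s = length-filter-tabulate (λ x → deg G x + 10 * s ≤? 4 * n) id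

  degreeSum+lowDegCount≤ : ∀ {s} → Admissible s G →
    degreeSum + 11 * s * lowDegCount G s ≤ s * n + 4 * n * lowDegCount G s
  degreeSum+lowDegCount≤ {s} admissible = begin
    degreeSum + 11 * s * lowDegCount G s
      ≡⟨ cong (λ l → degreeSum + 11 * s * l) (lowDegCount≡∑ s) ⟩
    ∑[ x < n ] deg G x + 11 * s * ∑[ x < n ] low x
      ≡⟨ cong (degreeSum +_) (*-distribˡ-sum (11 * s) low) ⟩
    ∑[ x < n ] deg G x + ∑[ x < n ] (11 * s * low x)
      ≡⟨ ∑-distrib-+ (deg G) (λ x → 11 * s * low x) ⟨
    ∑[ x < n ] (deg G x + 11 * s * low x)
      ≤⟨ ∑-mono-≤ (λ x → vertexBound (deg≤α admissible x) (deg G x + 10 * s ≤? 4 * n)) ⟩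
    ∑[ x < n ] (s + 4 * n * low x)
      ≡⟨ ∑-distrib-+ (λ _ → s) (λ x → 4 * n * low x) ⟩
    ∑[ x < n ] s + ∑[ x < n ] (4 * n * low x)
      ≡⟨ cong₂ _+_ (trans (∑-const n s) (*-comm n s)) (sym (*-distribˡ-sum (4 * n) low)) ⟩
    s * n + 4 * n * ∑[ x < n ] low x
      ≡⟨ cong (λ l → s * n + 4 * n * l) (lowDegCount≡∑ s) ⟨
    s * n + 4 * n * lowDegCount G s
      ∎
    where
    open ≤-Reasoning
    low : Fin n → ℕ
    low x = 𝟙 (does (deg G x + 10 * s ≤? 4 * n))
    regroup : ∀ d s → d + 11 * s ≡ s + (d + 10 * s)
    regroup = solve-∀
    vertexBound : ∀ {d} → d ≤ s → (low? : Dec (d + 10 * s ≤ 4 * n)) →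
      d + 11 * s * 𝟙 (does low?) ≤ s + 4 * n * 𝟙 (does low?)
    vertexBound {d} d≤s (no _)
      rewrite *-zeroʳ (11 * s) | *-zeroʳ (4 * n) | +-identityʳ d | +-identityʳ s = d≤s
    vertexBound {d} d≤s (yes isLow)
      rewrite *-identityʳ (11 * s) | *-identityʳ (4 * n) | regroup d s = +-monoʳ-≤ s isLow

-- Blow-ups

fibreSize : ∀ {n k} → (Fin n → Fin k) → Fin k → ℕ
fibreSize {n} p j = ∑[ y < n ] 𝟙 (does (p y ≟ j))

∑-fibres : ∀ {n k} (p : Fin n → Fin k) (g : Fin k → ℕ) →
  ∑[ y < n ] g (p y) ≡ ∑[ j < k ] (fibreSize p j * g j)
∑-fibres {n} {k} p g = begin
  ∑[ y < n ] g (p y)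
    ≡⟨ sum-cong-≗ (λ y → ∑-𝟙≟ (p y) g) ⟨
  ∑[ y < n ] ∑[ j < k ] (𝟙 (does (p y ≟ j)) * g j)
    ≡⟨ ∑-comm (λ y j → 𝟙 (does (p y ≟ j)) * g j) ⟩
  ∑[ j < k ] ∑[ y < n ] (𝟙 (does (p y ≟ j)) * g j)
    ≡⟨ sum-cong-≗ (λ j → *-distribʳ-sum (g j) (λ y → 𝟙 (does (p y ≟ j)))) ⟨
  ∑[ j < k ] (fibreSize p j * g j)
    ∎
  where open ≡-Reasoning

image : ∀ {n k} → (Fin n → Fin k) → Subset n → Subset k
image p S = tabulate λ j → does (any? λ y → y ∈? S ×-dec p y ≟ j)

module _ {n k} (p : Fin n → Fin k) (S : Subset n) where

  ∈-image⁻ : ∀ {j} → j ∈ image p S → ∃ λ y → y ∈ S × p y ≡ j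
  ∈-image⁻ {j} j∈ with any? (λ y → y ∈? S ×-dec p y ≟ j) | ∈-tabulate⁻ j∈
  ... | yes witness | _ = witness
  ... | no _ | ()

  ∈-image⁺ : ∀ {y} → y ∈ S → p y ∈ image p S
  ∈-image⁺ {y} y∈ = ∈-tabulate⁺ (dec-true (any? λ z → z ∈? S ×-dec p z ≟ p y) (y , y∈ , refl))

  ∣∣≤∑fibreSize-image : ∣ S ∣ ≤ ∑[ j < k ] (fibreSize p j * 𝟙 (lookup (image p S) j))
  ∣∣≤∑fibreSize-image = begin
    ∣ S ∣                                                   ≡⟨ ∣∣≡∑𝟙 S ⟩
    ∑[ y < n ] 𝟙 (lookup S y)                               ≤⟨ ∑-mono-≤ lookup≤lookup-image ⟩
    ∑[ y < n ] 𝟙 (lookup (image p S) (p y))                 ≡⟨ ∑-fibres p (λ j → 𝟙 (lookup (image p S) j)) ⟩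
    ∑[ j < k ] (fibreSize p j * 𝟙 (lookup (image p S) j))  ∎
    where
    open ≤-Reasoning
    lookup≤lookup-image : ∀ y → 𝟙 (lookup S y) ≤ 𝟙 (lookup (image p S) (p y))
    lookup≤lookup-image y with lookup S y in y∈
    ... | false = z≤n
    ... | true rewrite []=⇒lookup (∈-image⁺ (lookup⇒[]= y S y∈)) = ≤-refl

module _ {k} (P : Graph k) {n} (p : Fin n → Fin k) where

  blowUp : Graph n
  blowUp = record
    { adj = λ x y → adj P (p x) (p y)
    ; sym = λ x y → Graph.sym P (p x) (p y)
    ; irref = λ x → irref P (p x)
    }

  blowUp-triangleFree : TriangleFree P → TriangleFree blowUp
  blowUp-triangleFree triangleFree x y z = triangleFree (p x) (p y) (p z)

  degreeSum-blowUp : degreeSum blowUp ≡ ∑[ i < k ] (fibreSize p i * ∑[ j < k ] (fibreSize p j * 𝟙 (adj P i j)))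
  degreeSum-blowUp = begin
    ∑[ x < n ] deg blowUp x
      ≡⟨ sum-cong-≗ (deg≡∑adj blowUp) ⟩
    ∑[ x < n ] ∑[ y < n ] 𝟙 (adj P (p x) (p y))
      ≡⟨ sum-cong-≗ (λ x → ∑-fibres p (λ j → 𝟙 (adj P (p x) j))) ⟩
    ∑[ x < n ] ∑[ j < k ] (fibreSize p j * 𝟙 (adj P (p x) j))
      ≡⟨ ∑-fibres p (λ i → ∑[ j < k ] (fibreSize p j * 𝟙 (adj P i j))) ⟩
    ∑[ i < k ] (fibreSize p i * ∑[ j < k ] (fibreSize p j * 𝟙 (adj P i j)))
      ∎
    where open ≡-Reasoning

  image-independent : ∀ {S} → Independent blowUp S → Independent P (image p S)
  image-independent independentS i j i∈ j∈ with ∈-image⁻ p _ i∈ | ∈-image⁻ p _ j∈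
  ... | x , x∈ , refl | y , y∈ , refl = independentS x y x∈ y∈

  blowUp-αAtMost : ∀ {s} → (∀ T → Independent P T → ∑[ j < k ] (fibreSize p j * 𝟙 (lookup T j)) ≤ s) →
    αAtMost blowUp s
  blowUp-αAtMost weight≤s S independentS =
    ≤-trans (∣∣≤∑fibreSize-image p S) (weight≤s _ (image-independent independentS))

-- The Andrásfai graph And(4) and its balanced blow-ups

-- ℤ/11 with i ~ j iff j − i ∈ {1, 4, 7, 10} (mod 11).
andrasfaiAdj : Fin 11 → Fin 11 → Bool
andrasfaiAdj i j = (11 + toℕ j ∸ toℕ i) % 11 % 3 ≡ᵇ 1

andrasfai : Graph 11
andrasfai = record
  { adj = andrasfaiAdj
  ; sym = toWitness {a? = all? λ i → all? λ j → andrasfaiAdj i j ≟ᵇ andrasfaiAdj j i} _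
  ; irref = toWitness {a? = all? λ i → andrasfaiAdj i i ≟ᵇ false} _
  }

andrasfai-triangleFree : TriangleFree andrasfai
andrasfai-triangleFree = toWitness {a? = triangleFree? andrasfai} _

below : ℕ → Fin 11 → ℕ
below r j = 𝟙 (toℕ j <ᵇ r)

andrasfai-independentSets : ∀ T → Independent andrasfai T →
  ∣ T ∣ ≤ 4 × (∀ (r : Fin 11) → ∑[ j < 11 ] (below (toℕ r) j * 𝟙 (lookup T j)) ≤ suc (4 * toℕ r / 11))
andrasfai-independentSets = toWitness {a? = allSubsets? λ T → independent? andrasfai T →-dec
  (∣ T ∣ ≤? 4 ×-dec all? λ r → ∑[ j < 11 ] (below (toℕ r) j * 𝟙 (lookup T j)) ≤? suc (4 * toℕ r / 11))} _

-- Defined by pattern matching so that residue (11 + y) = residue y holds definitionally.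
residue : ℕ → Fin 11
residue (suc (suc (suc (suc (suc (suc (suc (suc (suc (suc (suc y))))))))))) = residue y
residue 0 = # 0
residue 1 = # 1
residue 2 = # 2
residue 3 = # 3
residue 4 = # 4
residue 5 = # 5
residue 6 = # 6
residue 7 = # 7
residue 8 = # 8
residue 9 = # 9
residue 10 = # 10

fibreSize-residue : ∀ q (r : Fin 11) j → fibreSize {q * 11 + toℕ r} (residue ∘ toℕ) j ≡ q + below (toℕ r) j
fibreSize-residue zero = toWitness {a? = all? λ r → all? λ j →
  fibreSize {toℕ r} (residue ∘ toℕ) j ≟ℕ below (toℕ r) j} _
fibreSize-residue (suc q) r j = begin
  fibreSize {11 + (q * 11 + toℕ r)} (residue ∘ toℕ) j
    ≡⟨ ∑-↑ 11 {q * 11 + toℕ r} (λ y → 𝟙 (does (residue (toℕ y) ≟ j))) ⟩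
  fibreSize {11} (residue ∘ toℕ) j + fibreSize {q * 11 + toℕ r} (residue ∘ toℕ) j
    ≡⟨ cong₂ _+_ (fibreSize-period j) (fibreSize-residue q r j) ⟩
  suc (q + below (toℕ r) j)
    ∎
  where
  open ≡-Reasoning
  fibreSize-period : ∀ j → fibreSize {11} (residue ∘ toℕ) j ≡ 1
  fibreSize-period = toWitness {a? = all? λ j → fibreSize {11} (residue ∘ toℕ) j ≟ℕ 1} _

andrasfaiBlowUp : (n : ℕ) → Graph n
andrasfaiBlowUp n = blowUp andrasfai (residue ∘ toℕ)

andrasfaiBlowUp-triangleFree : ∀ n → TriangleFree (andrasfaiBlowUp n)
andrasfaiBlowUp-triangleFree n = blowUp-triangleFree andrasfai (residue ∘ toℕ) andrasfai-triangleFree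

divMod-elim : ∀ d .{{_ : NonZero d}} (P : ℕ → Set) → (∀ q (r : Fin d) → P (q * d + toℕ r)) → ∀ n → P n
divMod-elim d P P[qd+r] n with n divMod d
... | result q r n≡r+qd = subst P (sym (trans n≡r+qd (+-comm (toℕ r) (q * d)))) (P[qd+r] q r)

4[q*11+r]/11≡q*4+4r/11 : ∀ q r → 4 * (q * 11 + r) / 11 ≡ q * 4 + 4 * r / 11
4[q*11+r]/11≡q*4+4r/11 q r = begin
  4 * (q * 11 + r) / 11         ≡⟨ cong (_/ 11) (distribute q r) ⟩
  (q * 4 * 11 + 4 * r) / 11     ≡⟨ +-distrib-/-∣ˡ (4 * r) (n∣m*n (q * 4)) ⟩
  q * 4 * 11 / 11 + 4 * r / 11  ≡⟨ cong (_+ 4 * r / 11) (m*n/n≡m (q * 4) 11) ⟩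
  q * 4 + 4 * r / 11            ∎
  where
  open ≡-Reasoning
  distribute : ∀ q r → 4 * (q * 11 + r) ≡ q * 4 * 11 + 4 * r
  distribute = solve-∀

α-andrasfaiBlowUp : ∀ n → αAtMost (andrasfaiBlowUp n) (suc (4 * n / 11))
α-andrasfaiBlowUp = divMod-elim 11 (λ n → αAtMost (andrasfaiBlowUp n) (suc (4 * n / 11))) λ q r →
  subst (αAtMost (andrasfaiBlowUp (q * 11 + toℕ r)))
    (trans (+-suc (q * 4) (4 * toℕ r / 11)) (cong suc (sym (4[q*11+r]/11≡q*4+4r/11 q (toℕ r)))))
    (blowUp-αAtMost andrasfai (residue ∘ toℕ) (weight≤ q r))
  where
  weight≤ : ∀ q r T → Independent andrasfai T →
    ∑[ j < 11 ] (fibreSize {q * 11 + toℕ r} (residue ∘ toℕ) j * 𝟙 (lookup T j)) ≤ q * 4 + suc (4 * toℕ r / 11)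
  weight≤ q r T independentT = begin
    ∑[ j < 11 ] (fibreSize {q * 11 + toℕ r} (residue ∘ toℕ) j * 𝟙 (lookup T j))
      ≡⟨ sum-cong-≗ (λ j → cong (_* 𝟙 (lookup T j)) (fibreSize-residue q r j)) ⟩
    ∑[ j < 11 ] ((q + below (toℕ r) j) * 𝟙 (lookup T j))
      ≡⟨ ∑-shifted-weights q (below (toℕ r)) (λ j → 𝟙 (lookup T j)) ⟩
    q * ∑[ j < 11 ] 𝟙 (lookup T j) + ∑[ j < 11 ] (below (toℕ r) j * 𝟙 (lookup T j))
      ≡⟨ cong (λ t → q * t + ∑[ j < 11 ] (below (toℕ r) j * 𝟙 (lookup T j))) (∣∣≡∑𝟙 T) ⟨
    q * ∣ T ∣ + ∑[ j < 11 ] (below (toℕ r) j * 𝟙 (lookup T j))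
      ≤⟨ +-mono-≤ (*-monoʳ-≤ q (proj₁ bounds)) (proj₂ bounds r) ⟩
    q * 4 + suc (4 * toℕ r / 11)
      ∎
    where
    open ≤-Reasoning
    bounds = andrasfai-independentSets T independentT

degreeSumBelow : ℕ → ℕ
degreeSumBelow r = ∑[ i < 11 ] (below r i * ∑[ j < 11 ] (below r j * 𝟙 (andrasfaiAdj i j)))

degreeSum-andrasfaiBlowUp : ∀ q (r : Fin 11) →
  degreeSum (andrasfaiBlowUp (q * 11 + toℕ r)) ≡ q * q * 44 + q * (8 * toℕ r) + degreeSumBelow (toℕ r)
degreeSum-andrasfaiBlowUp q r = begin
  degreeSum (andrasfaiBlowUp (q * 11 + toℕ r))
    ≡⟨ degreeSum-blowUp andrasfai {q * 11 + toℕ r} (residue ∘ toℕ) ⟩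
  ∑[ i < 11 ] (w i * ∑[ j < 11 ] (w j * a i j))
    ≡⟨ sum-cong-≗ (λ i → cong₂ _*_ (fibreSize-residue q r i)
                                   (sum-cong-≗ λ j → cong (_* a i j) (fibreSize-residue q r j))) ⟩
  ∑[ i < 11 ] ((q + c i) * ∑[ j < 11 ] ((q + c j) * a i j))
    ≡⟨ ∑-shifted-quadraticForm q c a ⟩
  q * q * ∑[ i < 11 ] ∑[ j < 11 ] a i j + q * ∑[ i < 11 ] (c i * ∑[ j < 11 ] a i j + ∑[ j < 11 ] (c j * a i j))
    + degreeSumBelow (toℕ r)
    ≡⟨ cong (λ m → q * q * 44 + q * m + degreeSumBelow (toℕ r)) (linearCoefficient r) ⟩
  q * q * 44 + q * (8 * toℕ r) + degreeSumBelow (toℕ r)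
    ∎
  where
  open ≡-Reasoning
  w c : Fin 11 → ℕ
  w = fibreSize {q * 11 + toℕ r} (residue ∘ toℕ)
  c = below (toℕ r)
  a : Fin 11 → Fin 11 → ℕ
  a i j = 𝟙 (andrasfaiAdj i j)
  linearCoefficient : ∀ (r : Fin 11) →
    ∑[ i < 11 ] (below (toℕ r) i * ∑[ j < 11 ] a i j + ∑[ j < 11 ] (below (toℕ r) j * a i j)) ≡ 8 * toℕ r
  linearCoefficient = toWitness {a? = all? λ r →
    ∑[ i < 11 ] (below (toℕ r) i * ∑[ j < 11 ] a i j + ∑[ j < 11 ] (below (toℕ r) j * a i j)) ≟ℕ 8 * toℕ r} _

slack : ℕ → ℕ
slack n = 11 * suc (4 * n / 11) ∸ 4 * n

4n+slack≡11[1+4n/11] : ∀ n → 4 * n + slack n ≡ 11 * suc (4 * n / 11)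
4n+slack≡11[1+4n/11] n = m+[n∸m]≡n (begin
  4 * n                         ≡⟨ m≡m%n+[m/n]*n (4 * n) 11 ⟩
  4 * n % 11 + 4 * n / 11 * 11  ≤⟨ +-mono-≤ (m%n≤n (4 * n) 11) ≤-refl ⟩
  11 + 4 * n / 11 * 11          ≡⟨ regroup (4 * n / 11) ⟩
  11 * suc (4 * n / 11)         ∎)
  where
  open ≤-Reasoning
  regroup : ∀ m → 11 + m * 11 ≡ 11 * suc m
  regroup = solve-∀

slack-residue : ∀ q r → slack (q * 11 + r) ≡ slack r
slack-residue q r = begin
  11 * suc (4 * (q * 11 + r) / 11) ∸ 4 * (q * 11 + r)
    ≡⟨ cong₂ (λ m o → 11 * suc m ∸ o) (4[q*11+r]/11≡q*4+4r/11 q r) (expand₁ q r) ⟩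
  11 * suc (q * 4 + 4 * r / 11) ∸ (q * 44 + 4 * r)
    ≡⟨ cong (_∸ (q * 44 + 4 * r)) (expand₂ q (4 * r / 11)) ⟩
  (q * 44 + 11 * suc (4 * r / 11)) ∸ (q * 44 + 4 * r)
    ≡⟨ [m+n]∸[m+o]≡n∸o (q * 44) _ _ ⟩
  11 * suc (4 * r / 11) ∸ 4 * r
    ∎
  where
  open ≡-Reasoning
  expand₁ : ∀ q r → 4 * (q * 11 + r) ≡ q * 44 + 4 * r
  expand₁ = solve-∀
  expand₂ : ∀ q t → 11 * suc (q * 4 + t) ≡ q * 44 + 11 * suc t
  expand₂ = solve-∀

andrasfaiBlowUp-dense : ∀ n → 4 * n * n < 11 * degreeSum (andrasfaiBlowUp n) + 3 * slack n * slack n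
andrasfaiBlowUp-dense = divMod-elim 11 (λ n → 4 * n * n < 11 * degreeSum (andrasfaiBlowUp n) + 3 * slack n * slack n)
  λ q r → let n = q * 11 + toℕ r ; E = degreeSumBelow (toℕ r) ; d = slack (toℕ r) in begin-strict
  4 * n * n
    ≡⟨ expand₁ q (toℕ r) ⟩
  11 * (q * q * 44 + q * (8 * toℕ r)) + 4 * toℕ r * toℕ r
    <⟨ +-monoʳ-< (11 * (q * q * 44 + q * (8 * toℕ r))) (residueInequality r) ⟩
  11 * (q * q * 44 + q * (8 * toℕ r)) + (11 * E + 3 * d * d)
    ≡⟨ expand₂ q (toℕ r) E d ⟩
  11 * (q * q * 44 + q * (8 * toℕ r) + E) + 3 * d * d
    ≡⟨ cong₂ (λ m o → 11 * m + 3 * o * o) (degreeSum-andrasfaiBlowUp q r) (slack-residue q (toℕ r)) ⟨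
  11 * degreeSum (andrasfaiBlowUp n) + 3 * slack n * slack n
    ∎
  where
  open ≤-Reasoning
  expand₁ : ∀ q r → 4 * (q * 11 + r) * (q * 11 + r) ≡ 11 * (q * q * 44 + q * (8 * r)) + 4 * r * r
  expand₁ = solve-∀
  expand₂ : ∀ q r E d →
    11 * (q * q * 44 + q * (8 * r)) + (11 * E + 3 * d * d) ≡ 11 * (q * q * 44 + q * (8 * r) + E) + 3 * d * d
  expand₂ = solve-∀
  residueInequality : ∀ (r : Fin 11) →
    4 * toℕ r * toℕ r < 11 * degreeSumBelow (toℕ r) + 3 * slack (toℕ r) * slack (toℕ r)
  residueInequality = toWitness {a? = all? λ r →
    4 * toℕ r * toℕ r <ℕ? 11 * degreeSumBelow (toℕ r) + 3 * slack (toℕ r) * slack (toℕ r)} _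

-- The counting argument

lowDegCount-arithmetic : ∀ n s L X d →
  X + 11 * s * L ≤ s * n + 4 * n * L → 4 * n + d ≤ 11 * s → 4 * n * n < 11 * X + 3 * d * d →
  L + n < 3 * s
lowDegCount-arithmetic n s L X d degreeBound slackBound density
  with m≤n⇒∃[o]m+o≡n (≤-trans (m≤m+n (4 * n) d) slackBound)
... | D , 4n+D≡11s = *-cancelˡ-< 11 (L + n) (3 * s) (begin-strict
    11 * (L + n)        ≡⟨ *-distribˡ-+ 11 L n ⟩
    11 * L + 11 * n     <⟨ +-monoˡ-< (11 * n) 11L<n+3D ⟩
    n + 3 * D + 11 * n  ≡⟨ ring₁ n D ⟩
    3 * (4 * n + D)     ≡⟨ cong (3 *_) 4n+D≡11s ⟩
    3 * (11 * s)        ≡⟨ ring₂ s ⟩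
    11 * (3 * s)        ∎)
  where
  open ≤-Reasoning
  ring₁ : ∀ n D → n + 3 * D + 11 * n ≡ 3 * (4 * n + D)
  ring₁ = solve-∀
  ring₂ : ∀ s → 3 * (11 * s) ≡ 11 * (3 * s)
  ring₂ = solve-∀
  ring₃ : ∀ X L n D → 11 * X + 11 * L * D + 44 * n * L ≡ 11 * X + 11 * L * (4 * n + D)
  ring₃ = solve-∀
  ring₄ : ∀ X L s → 11 * X + 11 * L * (11 * s) ≡ 11 * (X + 11 * s * L)
  ring₄ = solve-∀
  ring₅ : ∀ s n L → 11 * (s * n + 4 * n * L) ≡ n * (11 * s) + 44 * n * L
  ring₅ = solve-∀
  ring₆ : ∀ n D L → n * (4 * n + D) + 44 * n * L ≡ 4 * n * n + n * D + 44 * n * L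
  ring₆ = solve-∀
  ring₇ : ∀ X D L → 11 * X + D * (11 * L) ≡ 11 * X + 11 * L * D
  ring₇ = solve-∀
  ring₈ : ∀ X D n → 11 * X + 3 * D * D + n * D ≡ 11 * X + D * (n + 3 * D)
  ring₈ = solve-∀
  d≤D : d ≤ D
  d≤D = +-cancelˡ-≤ (4 * n) d D (subst (4 * n + d ≤_) (sym 4n+D≡11s) slackBound)
  weighted : 11 * X + 11 * L * D ≤ 4 * n * n + n * D
  weighted = +-cancelʳ-≤ (44 * n * L) _ _ (begin
    11 * X + 11 * L * D + 44 * n * L ≡⟨ ring₃ X L n D ⟩
    11 * X + 11 * L * (4 * n + D)    ≡⟨ cong (λ m → 11 * X + 11 * L * m) 4n+D≡11s ⟩
    11 * X + 11 * L * (11 * s)       ≡⟨ ring₄ X L s ⟩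
    11 * (X + 11 * s * L)            ≤⟨ *-monoʳ-≤ 11 degreeBound ⟩
    11 * (s * n + 4 * n * L)         ≡⟨ ring₅ s n L ⟩
    n * (11 * s) + 44 * n * L        ≡⟨ cong (λ m → n * m + 44 * n * L) 4n+D≡11s ⟨
    n * (4 * n + D) + 44 * n * L     ≡⟨ ring₆ n D L ⟩
    4 * n * n + n * D + 44 * n * L   ∎)
  3dd≤3DD : 3 * d * d ≤ 3 * D * D
  3dd≤3DD = *-mono-≤ (*-monoʳ-≤ 3 d≤D) d≤D
  11L<n+3D : 11 * L < n + 3 * D
  11L<n+3D = *-cancelˡ-< D (11 * L) (n + 3 * D) (+-cancelˡ-< (11 * X) _ _ (begin-strict
    11 * X + D * (11 * L)       ≡⟨ ring₇ X D L ⟩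
    11 * X + 11 * L * D         ≤⟨ weighted ⟩
    4 * n * n + n * D           <⟨ +-monoˡ-< (n * D) (<-≤-trans density (+-monoʳ-≤ (11 * X) 3dd≤3DD)) ⟩
    11 * X + 3 * D * D + n * D  ≡⟨ ring₈ X D n ⟩
    11 * X + D * (n + 3 * D)    ∎))

lemma3p6 : (n s : ℕ) → s ≤ n → 4 * n < 11 * s → 8 * s < 3 * n →
    (G : Graph n) → Extremal n s G →
    lowDegCount G s + n < 3 * s
lemma3p6 n s _ 4n<11s _ G ((triangleFree , α≤s) , maximal) =
  lowDegCount-arithmetic n s (lowDegCount G s) (degreeSum H) (slack n)
    (≤-trans (+-monoˡ-≤ _ H≤G) (degreeSum+lowDegCount≤ G (triangleFree , α≤s)))
    (subst (_≤ 11 * s) (sym (4n+slack≡11[1+4n/11] n)) (*-monoʳ-≤ 11 1+4n/11≤s))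
    (andrasfaiBlowUp-dense n)
  where
  H = andrasfaiBlowUp n
  1+4n/11≤s : suc (4 * n / 11) ≤ s
  1+4n/11≤s = m<n*o⇒m/o<n (subst (4 * n <_) (*-comm 11 s) 4n<11s)
  H-admissible : Admissible s H
  H-admissible = andrasfaiBlowUp-triangleFree n ,
                 λ S independentS → ≤-trans (α-andrasfaiBlowUp n S independentS) 1+4n/11≤s
  H≤G : degreeSum H ≤ degreeSum G
  H≤G = subst₂ _≤_ (sym (handshake H)) (sym (handshake G)) (+-mono-≤ eH≤eG eH≤eG)
    where eH≤eG = maximal H H-admissible
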